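{- Let $n\ge 1$ and let $\bar A=(a_{i,j})_{1\le i<j\le 2n}$ be the triangular array with $a_{i,j}=(x_i-x_j)^2$, where $x_1,\ldots,x_{2n}$ are indeterminates over a field of characteristic different from $2$. Then $$pf_{2n}\bar A=-(-2)^{n-1}(x_1-x_2)(x_2-x_3)\cdots(x_{2n-1}-x_{2n})(x_{2n}-x_1).$$
   Context: For a triangular array $\bar A=(a_{i,j})_{1\le i<j\le 2n}$ its Pfaffian is $pf_{2n}\bar A=\sum_{\pi}\operatorname{sign}(\pi)\,a_{i_1,j_1}\cdots a_{i_n,j_n}$, the sum over all permutations $\pi\in S_{2n}$ with one-line notation $(i_1,j_1,\ldots,i_n,j_n)$ satisfying $i_1<i_2<\cdots<i_n$ and $i_s<j_s$ for all $s$; $\operatorname{sign}(\pi)$ is the sign of the permutation. -}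

module Defs where

open import Level using (Level)
open import Data.Bool using (Bool; true; false; _∧_)
open import Data.Nat as ℕ using (ℕ; zero; suc; _<ᵇ_)
open import Data.Fin using (Fin; toℕ)
open import Data.Product using (_×_; _,_)
open import Data.List using (List; []; _∷_; map; foldr; concatMap; filterᵇ; allFin)
open import Algebra.Bundles using (CommutativeRing)

insertAll : {a : Level} {A : Set a} → A → List A → List (List A)
insertAll x []       = (x ∷ []) ∷ []
insertAll x (y ∷ ys) = (x ∷ y ∷ ys) ∷ map (y ∷_) (insertAll x ys)

permutations : {a : Level} {A : Set a} → List A → List (List A)
permutations []       = [] ∷ []
permutations (x ∷ xs) = concatMap (insertAll x) (permutations xs)

Perms : (m : ℕ) → List (List (Fin m))
Perms m = permutations (allFin m)

countSmaller : {m : ℕ} → Fin m → List (Fin m) → ℕ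
countSmaller x []       = 0
countSmaller x (y ∷ ys) with toℕ y <ᵇ toℕ x
... | true  = suc (countSmaller x ys)
... | false = countSmaller x ys

inversions : {m : ℕ} → List (Fin m) → ℕ
inversions []       = 0
inversions (x ∷ xs) = countSmaller x xs ℕ.+ inversions xs

pairsOf : {a : Level} {A : Set a} → List A → List (A × A)
pairsOf (i ∷ j ∷ rest) = (i , j) ∷ pairsOf rest
pairsOf _              = []

pairsOrdered : {m : ℕ} → List (Fin m × Fin m) → Bool
pairsOrdered []             = true
pairsOrdered ((i , j) ∷ ps) = (toℕ i <ᵇ toℕ j) ∧ pairsOrdered ps

firstsIncreasing : {m : ℕ} → List (Fin m × Fin m) → Bool
firstsIncreasing []                            = true
firstsIncreasing ((i , _) ∷ [])                = true
firstsIncreasing ((i , _) ∷ (i' , j') ∷ ps)    =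
  (toℕ i <ᵇ toℕ i') ∧ firstsIncreasing ((i' , j') ∷ ps)

admissible : {m : ℕ} → List (Fin m) → Bool
admissible π = pairsOrdered (pairsOf π) ∧ firstsIncreasing (pairsOf π)

module _ {c ℓ : Level} (R : CommutativeRing c ℓ) where
  open CommutativeRing R

  pow : Carrier → ℕ → Carrier
  pow x zero    = 1#
  pow x (suc k) = x * pow x k

  sumR : List Carrier → Carrier
  sumR = foldr _+_ 0#

  prodR : List Carrier → Carrier
  prodR = foldr _*_ 1#

  two : Carrier
  two = 1# + 1#

  sign : {m : ℕ} → List (Fin m) → Carrier
  sign π = pow (- 1#) (inversions π)

  -- Pfaffian of the triangular array (a i j)_{i<j} of size m (indices 0..m-1);
  -- only entries with i < j are ever used.
  pf : (m : ℕ) → (Fin m → Fin m → Carrier) → Carrier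
  pf m a = sumR (map term (filterᵇ admissible (Perms m)))
    where
      term : List (Fin m) → Carrier
      term π = sign π * prodR (map (λ { (i , j) → a i j }) (pairsOf π))

  -- cyclic product (y₀ - y₁)(y₁ - y₂)⋯(y_{k-1} - y_k)(y_k - y₀) for [y₀,…,y_k]
  cycGo : Carrier → List Carrier → Carrier
  cycGo first []           = 1#
  cycGo first (y ∷ [])     = y - first
  cycGo first (y ∷ z ∷ ys) = (y - z) * cycGo first (z ∷ ys)

  cyclicDiffProd : List Carrier → Carrier
  cyclicDiffProd []       = 1#
  cyclicDiffProd (y ∷ ys) = cycGo y (y ∷ ys)

{-# OPTIONS --safe #-}
-- Expanding the Pfaffian along its first row gives
--   pf(x₁, …, x₂ₙ) = Σⱼ (-1)ʲ (x₁ - xⱼ)² pf(x₁, …, x₂ₙ without x₁, xⱼ),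
-- so by induction on n everything reduces to the polynomial identity
--   Σᵢ (-1)ⁱ⁻¹ (v - wᵢ)² C(w without wᵢ) = -2 C(v, w)
-- for w of odd length at least 3, where C(y₀, …, yₖ) = (y₀ - y₁)⋯(yₖ₋₁ - yₖ)(yₖ - y₀).
-- That identity follows by induction on the length of w once it is generalised
-- to open chains (b - r₁)(r₁ - r₂)⋯(rₖ - z) with free endpoints b and z.
module Submission where

open import Defs
open import Level using (Level)
open import Function using (id; _∘_; Equivalence)
open import Relation.Nullary using (¬_; yes; no)
open import Relation.Binary.PropositionalEquality as ≡ using (_≡_)
open import Data.Empty using (⊥-elim)
open import Data.Bool using (Bool; true; false; _∧_; if_then_else_)
open import Data.Bool.Properties using (T-≡)
open import Data.Maybe using (Maybe; just; nothing)
open import Data.Product using (_×_; _,_; proj₁; proj₂; uncurry)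
open import Data.Nat as ℕ using (ℕ; zero; suc; _<ᵇ_; s≤s; z≤n)
import Data.Nat.Properties as ℕ
open import Data.Integer as ℤ using (ℤ; +_; -[1+_]; _⊖_)
import Data.Integer.Properties as ℤ
open import Data.Sign as Sign using (Sign)
open import Data.Fin using (Fin; toℕ; _<_)
open import Data.List using (List; []; _∷_; length; map; _++_; concatMap; filter; filterᵇ; allFin)
import Data.List.Properties as List
open import Data.List.Relation.Unary.All as All using (All; []; _∷_)
import Data.List.Relation.Unary.All.Properties as All
open import Data.List.Relation.Unary.AllPairs using (AllPairs; []; _∷_)
import Data.List.Relation.Unary.AllPairs.Properties as AllPairs
open import Data.List.Relation.Binary.Permutation.Propositional as ↭ using (_↭_)
open import Data.List.Relation.Binary.Permutation.Propositional.Properties using (All-resp-↭; ↭-length; filter-↭)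
open import Algebra.Bundles using (CommutativeRing)
import Algebra.Solver.Ring.AlmostCommutativeRing as AlmostCommutativeRing

-- The ring solver needs coefficients with decidable equality, so we use ℤ through its canonical map into R.
module IntegerCoefficients {c ℓ : Level} (R : CommutativeRing c ℓ) where
  open CommutativeRing R
  open import Algebra.Properties.Ring ring using (-‿distribˡ-*; -‿distribʳ-*; -‿involutive; -0#≈0#)
  open import Algebra.Properties.AbelianGroup +-abelianGroup using (⁻¹-∙-comm)
  open import Algebra.Properties.Semiring.Mult.TCOptimised semiring using (1+×; ×-homo-+; ×1-homo-*)
    renaming (_×_ to _×ᴿ_)
  open import Relation.Binary.Reasoning.Setoid setoid

  -- This multiple has 1 ×ᴿ x = x definitionally, so the solver constant 1 evaluates to 1#.
  fromℕ : ℕ → Carrier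
  fromℕ n = n ×ᴿ 1#

  fromℤ : ℤ → Carrier
  fromℤ (+ n)    = fromℕ n
  fromℤ -[1+ n ] = - fromℕ (suc n)

  1+-‿1+ : ∀ a b → (1# + a) - (1# + b) ≈ a - b
  1+-‿1+ a b = begin
    (1# + a) + - (1# + b)    ≈⟨ +-congˡ (sym (⁻¹-∙-comm 1# b)) ⟩
    (1# + a) + (- 1# + - b)  ≈⟨ +-assoc _ _ _ ⟩
    1# + (a + (- 1# + - b))  ≈⟨ +-congˡ (sym (+-assoc _ _ _)) ⟩
    1# + ((a + - 1#) + - b)  ≈⟨ +-congˡ (+-congʳ (+-comm _ _)) ⟩
    1# + ((- 1# + a) + - b)  ≈⟨ +-congˡ (+-assoc _ _ _) ⟩
    1# + (- 1# + (a + - b))  ≈⟨ sym (+-assoc _ _ _) ⟩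
    (1# + - 1#) + (a + - b)  ≈⟨ +-congʳ (-‿inverseʳ _) ⟩
    0# + (a + - b)           ≈⟨ +-identityˡ _ ⟩
    a - b                    ∎

  fromℤ-⊖ : ∀ m n → fromℤ (m ⊖ n) ≈ fromℕ m - fromℕ n
  fromℤ-⊖ m       zero    = trans (sym (+-identityʳ _)) (+-congˡ (sym -0#≈0#))
  fromℤ-⊖ zero    (suc n) = sym (+-identityˡ _)
  fromℤ-⊖ (suc m) (suc n) = begin
    fromℤ (suc m ⊖ suc n)    ≡⟨ ≡.cong fromℤ (ℤ.[1+m]⊖[1+n]≡m⊖n m n) ⟩
    fromℤ (m ⊖ n)            ≈⟨ fromℤ-⊖ m n ⟩
    fromℕ m - fromℕ n        ≈⟨ sym (1+-‿1+ _ _) ⟩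
    (1# + fromℕ m) - (1# + fromℕ n) ≈⟨ +-cong (sym (1+× m 1#)) (-‿cong (sym (1+× n 1#))) ⟩
    fromℕ (suc m) - fromℕ (suc n) ∎

  fromℤ-+ : ∀ i j → fromℤ (i ℤ.+ j) ≈ fromℤ i + fromℤ j
  fromℤ-+ (+ m)    (+ n)    = ×-homo-+ 1# m n
  fromℤ-+ (+ m)    -[1+ n ] = fromℤ-⊖ m (suc n)
  fromℤ-+ -[1+ m ] (+ n)    = trans (fromℤ-⊖ n (suc m)) (+-comm _ _)
  fromℤ-+ -[1+ m ] -[1+ n ] = begin
    - fromℕ (suc (suc (m ℕ.+ n)))    ≡⟨ ≡.cong (λ k → - fromℕ (suc k)) (≡.sym (ℕ.+-suc m n)) ⟩
    - fromℕ (suc m ℕ.+ suc n)        ≈⟨ -‿cong (×-homo-+ 1# (suc m) (suc n)) ⟩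
    - (fromℕ (suc m) + fromℕ (suc n)) ≈⟨ sym (⁻¹-∙-comm _ _) ⟩
    - fromℕ (suc m) + - fromℕ (suc n) ∎

  signed : Sign → Carrier → Carrier
  signed Sign.+ x = x
  signed Sign.- x = - x

  signed-cong : ∀ s {x y} → x ≈ y → signed s x ≈ signed s y
  signed-cong Sign.+ p = p
  signed-cong Sign.- p = -‿cong p

  signed-* : ∀ s t x y → signed (s Sign.* t) (x * y) ≈ signed s x * signed t y
  signed-* Sign.+ Sign.+ x y = refl
  signed-* Sign.+ Sign.- x y = -‿distribʳ-* x y
  signed-* Sign.- Sign.+ x y = -‿distribˡ-* x y
  signed-* Sign.- Sign.- x y =
    trans (sym (-‿involutive _)) (trans (-‿cong (-‿distribˡ-* x y)) (-‿distribʳ-* (- x) y))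

  fromℤ-◃ : ∀ s n → fromℤ (s ℤ.◃ n) ≈ signed s (fromℕ n)
  fromℤ-◃ Sign.+ zero    = refl
  fromℤ-◃ Sign.- zero    = sym -0#≈0#
  fromℤ-◃ Sign.+ (suc n) = refl
  fromℤ-◃ Sign.- (suc n) = refl

  fromℤ-signAbs : ∀ i → fromℤ i ≈ signed (ℤ.sign i) (fromℕ ℤ.∣ i ∣)
  fromℤ-signAbs (+ n)    = refl
  fromℤ-signAbs -[1+ n ] = refl

  fromℤ-* : ∀ i j → fromℤ (i ℤ.* j) ≈ fromℤ i * fromℤ j
  fromℤ-* i j = begin
    fromℤ (i ℤ.* j)                        ≈⟨ fromℤ-◃ s (ℤ.∣ i ∣ ℕ.* ℤ.∣ j ∣) ⟩
    signed s (fromℕ (ℤ.∣ i ∣ ℕ.* ℤ.∣ j ∣))  ≈⟨ signed-cong s (×1-homo-* ℤ.∣ i ∣ ℤ.∣ j ∣) ⟩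
    signed s (fromℕ ℤ.∣ i ∣ * fromℕ ℤ.∣ j ∣) ≈⟨ signed-* (ℤ.sign i) (ℤ.sign j) _ _ ⟩
    signed (ℤ.sign i) (fromℕ ℤ.∣ i ∣) * signed (ℤ.sign j) (fromℕ ℤ.∣ j ∣)
                                            ≈⟨ *-cong (sym (fromℤ-signAbs i)) (sym (fromℤ-signAbs j)) ⟩
    fromℤ i * fromℤ j                      ∎
    where s = ℤ.sign i Sign.* ℤ.sign j

  fromℤ-neg : ∀ i → fromℤ (ℤ.- i) ≈ - fromℤ i
  fromℤ-neg (+ zero)  = sym -0#≈0#
  fromℤ-neg (+ suc n) = refl
  fromℤ-neg -[1+ n ]  = sym (-‿involutive _)

  homomorphism : ℤ.+-*-rawRing AlmostCommutativeRing.-Raw-AlmostCommutative⟶ AlmostCommutativeRing.fromCommutativeRing R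
  homomorphism = record
    { ⟦_⟧ = fromℤ ; +-homo = fromℤ-+ ; *-homo = fromℤ-* ; -‿homo = fromℤ-neg
    ; 0-homo = refl ; 1-homo = refl }

  fromℤ-weaklyInjective : ∀ i j → Maybe (fromℤ i ≈ fromℤ j)
  fromℤ-weaklyInjective i j with i ℤ.≟ j
  ... | yes i≡j = just (reflexive (≡.cong fromℤ i≡j))
  ... | no _    = nothing

  open import Algebra.Solver.Ring ℤ.+-*-rawRing (AlmostCommutativeRing.fromCommutativeRing R)
    homomorphism fromℤ-weaklyInjective public

data EvenLength {a} {A : Set a} : List A → Set a where
  []   : EvenLength []
  pair : ∀ {x y xs} → EvenLength xs → EvenLength (x ∷ y ∷ xs)

length≡2*⇒EvenLength : ∀ {a} {A : Set a} k (xs : List A) → length xs ≡ 2 ℕ.* k → EvenLength xs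
length≡2*⇒EvenLength zero    []       _ = []
length≡2*⇒EvenLength (suc k) xs       eq = pairUp xs (≡.trans eq (ℕ.*-suc 2 k))
  where
  pairUp : ∀ xs → length xs ≡ suc (suc (2 ℕ.* k)) → EvenLength xs
  pairUp (x ∷ y ∷ xs) eq = pair (length≡2*⇒EvenLength k xs (ℕ.suc-injective (ℕ.suc-injective eq)))

∧≡true : ∀ {b₁ b₂} → b₁ ∧ b₂ ≡ true → b₁ ≡ true × b₂ ≡ true
∧≡true {true} b₂≡true = ≡.refl , b₂≡true

<ᵇ⇒< : ∀ {m} {i j : Fin m} → (toℕ i <ᵇ toℕ j) ≡ true → i < j
<ᵇ⇒< {i = i} {j = j} e = ℕ.<ᵇ⇒< (toℕ i) (toℕ j) (Equivalence.from T-≡ e)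

<⇒<ᵇ : ∀ {m} {i j : Fin m} → i < j → (toℕ i <ᵇ toℕ j) ≡ true
<⇒<ᵇ i<j = Equivalence.to T-≡ (ℕ.<⇒<ᵇ i<j)

countSmaller≡length-filter : ∀ {m} (x : Fin m) ys → countSmaller x ys ≡ length (filter (λ y → toℕ y ℕ.<? toℕ x) ys)
countSmaller≡length-filter x []       = ≡.refl
countSmaller≡length-filter x (y ∷ ys) with toℕ y <ᵇ toℕ x
... | true  = ≡.cong suc (countSmaller≡length-filter x ys)
... | false = countSmaller≡length-filter x ys

countSmaller-↭ : ∀ {m} (y : Fin m) {π ρ} → π ↭ ρ → countSmaller y π ≡ countSmaller y ρ
countSmaller-↭ y {π} {ρ} π↭ρ = ≡.trans (countSmaller≡length-filter y π)
  (≡.trans (↭-length (filter-↭ (λ z → toℕ z ℕ.<? toℕ y) π↭ρ)) (≡.sym (countSmaller≡length-filter y ρ)))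

countSmaller-min : ∀ {m} (x : Fin m) ys → All (x <_) ys → countSmaller x ys ≡ 0
countSmaller-min x []       []           = ≡.refl
countSmaller-min x (y ∷ ys) (x<y ∷ x<ys) with toℕ y <ᵇ toℕ x in y<ᵇx
... | true  = ⊥-elim (ℕ.<-asym x<y (<ᵇ⇒< y<ᵇx))
... | false = countSmaller-min x ys x<ys

countSmaller-∷-< : ∀ {m} (y z : Fin m) r → z < y → countSmaller y (z ∷ r) ≡ suc (countSmaller y r)
countSmaller-∷-< y z r z<y rewrite <⇒<ᵇ z<y = ≡.refl

admissible-∷∷ : ∀ {m} {x y : Fin m} π → x < y → All (x <_) π → admissible (x ∷ y ∷ π) ≡ admissible π
admissible-∷∷ []          x<y _         rewrite <⇒<ᵇ x<y = ≡.refl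
admissible-∷∷ (_ ∷ [])    x<y _         rewrite <⇒<ᵇ x<y = ≡.refl
admissible-∷∷ (_ ∷ _ ∷ _) x<y (x<i ∷ _) rewrite <⇒<ᵇ x<y | <⇒<ᵇ x<i = ≡.refl

-- pairsOf ignores the last entry of an odd-length word, hence the parity hypothesis.
admissible⇒head-min : ∀ {m} (x : Fin m) π → EvenLength (x ∷ π) → admissible (x ∷ π) ≡ true → All (x <_) π
admissible⇒head-min x (y ∷ π) (pair π-even) adm =
  let x<ᵇy∧ordered , increasing = ∧≡true adm
      x<ᵇy , ordered = ∧≡true x<ᵇy∧ordered
  in <ᵇ⇒< x<ᵇy ∷ below-firsts x y π π-even ordered increasing
  where
  below-firsts : ∀ x y π → EvenLength π → pairsOrdered (pairsOf π) ≡ true →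
    firstsIncreasing ((x , y) ∷ pairsOf π) ≡ true → All (x <_) π
  below-firsts x y []          []           _       _          = []
  below-firsts x y (i ∷ j ∷ π) (pair π-even) ordered increasing =
    let i<ᵇj , ordered′    = ∧≡true ordered
        x<ᵇi , increasing′ = ∧≡true increasing
        x<i = <ᵇ⇒< x<ᵇi
    in x<i ∷ ℕ.<-trans x<i (<ᵇ⇒< i<ᵇj) ∷ All.map (ℕ.<-trans x<i) (below-firsts i j π π-even ordered′ increasing′)

module ListSums {c ℓ : Level} (R : CommutativeRing c ℓ) where
  open CommutativeRing R
  open IntegerCoefficients R using (solve; _:+_; _:*_; _:-_; _:=_)
  open import Algebra.Properties.Ring ring using (-0#≈0#)
  open import Algebra.Properties.AbelianGroup +-abelianGroup using (⁻¹-∙-comm)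
  open import Relation.Binary.Reasoning.Setoid setoid

  sumR-++ : ∀ xs ys → sumR R (xs ++ ys) ≈ sumR R xs + sumR R ys
  sumR-++ []       ys = sym (+-identityˡ _)
  sumR-++ (x ∷ xs) ys = trans (+-congˡ (sumR-++ xs ys)) (sym (+-assoc _ _ _))

  module _ {a} {A : Set a} where
    ∑ : (A → Carrier) → List A → Carrier
    ∑ f xs = sumR R (map f xs)

    ∑-congᴬ : ∀ {f g} {xs} → All (λ x → f x ≈ g x) xs → ∑ f xs ≈ ∑ g xs
    ∑-congᴬ []       = refl
    ∑-congᴬ (p ∷ ps) = +-cong p (∑-congᴬ ps)

    ∑-cong : ∀ {f g} xs → (∀ x → f x ≈ g x) → ∑ f xs ≈ ∑ g xs
    ∑-cong xs f≈g = ∑-congᴬ (All.universal f≈g xs)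

    ∑-zeroᴬ : ∀ {f} {xs} → All (λ x → f x ≈ 0#) xs → ∑ f xs ≈ 0#
    ∑-zeroᴬ []       = refl
    ∑-zeroᴬ (p ∷ ps) = trans (+-cong p (∑-zeroᴬ ps)) (+-identityˡ _)

    ∑-+ : ∀ f g xs → ∑ (λ x → f x + g x) xs ≈ ∑ f xs + ∑ g xs
    ∑-+ f g []       = sym (+-identityˡ _)
    ∑-+ f g (x ∷ xs) = trans (+-congˡ (∑-+ f g xs))
      (solve 4 (λ a b c d → (a :+ b) :+ (c :+ d) := (a :+ c) :+ (b :+ d)) refl (f x) (g x) (∑ f xs) (∑ g xs))

    ∑-*ˡ : ∀ k f xs → ∑ (λ x → k * f x) xs ≈ k * ∑ f xs
    ∑-*ˡ k f []       = sym (zeroʳ k)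
    ∑-*ˡ k f (x ∷ xs) = trans (+-congˡ (∑-*ˡ k f xs)) (sym (distribˡ _ _ _))

  ∑-concatMap : ∀ {a b} {A : Set a} {B : Set b} (f : B → Carrier) (g : A → List B) xs →
    ∑ f (concatMap g xs) ≈ ∑ (λ x → ∑ f (g x)) xs
  ∑-concatMap f g []       = refl
  ∑-concatMap f g (x ∷ xs) = begin
    sumR R (map f (g x ++ concatMap g xs))       ≡⟨ ≡.cong (sumR R) (List.map-++ f (g x) (concatMap g xs)) ⟩
    sumR R (map f (g x) ++ map f (concatMap g xs)) ≈⟨ sumR-++ (map f (g x)) _ ⟩
    ∑ f (g x) + ∑ f (concatMap g xs)             ≈⟨ +-congˡ (∑-concatMap f g xs) ⟩
    ∑ f (g x) + ∑ (λ x → ∑ f (g x)) xs           ∎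

  -- pickSum f [x₁, …, xₖ] = Σᵢ f xᵢ (x₁, …, xₖ without xᵢ); altPickSum weights the i-th term by (-1)ⁱ⁻¹.
  module _ {a} {A : Set a} where
    pickSum : (A → List A → Carrier) → List A → Carrier
    pickSum f []       = 0#
    pickSum f (z ∷ zs) = f z zs + pickSum (λ y r → f y (z ∷ r)) zs

    altPickSum : (A → List A → Carrier) → List A → Carrier
    altPickSum f []       = 0#
    altPickSum f (z ∷ zs) = f z zs - altPickSum (λ y r → f y (z ∷ r)) zs

    data Picked : A → List A → List A → Set a where
      here  : ∀ {z zs} → Picked z zs (z ∷ zs)
      there : ∀ {y r z zs} → Picked y r zs → Picked y (z ∷ r) (z ∷ zs)

    Picked-All : ∀ {p} {P : A → Set p} {y r xs} → Picked y r xs → All P xs → P y × All P r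
    Picked-All here       (p ∷ ps) = p , ps
    Picked-All (there pk) (p ∷ ps) = proj₁ (Picked-All pk ps) , p ∷ proj₂ (Picked-All pk ps)

    Picked-AllPairs : ∀ {r} {_~_ : A → A → Set r} {y rs xs} → Picked y rs xs → AllPairs _~_ xs → AllPairs _~_ rs
    Picked-AllPairs here       (_ ∷ ps) = ps
    Picked-AllPairs (there pk) (p ∷ ps) = proj₂ (Picked-All pk p) ∷ Picked-AllPairs pk ps

    Picked-length : ∀ {y r xs} → Picked y r xs → length xs ≡ suc (length r)
    Picked-length here       = ≡.refl
    Picked-length (there pk) = ≡.cong suc (Picked-length pk)

    pickSum-cong : ∀ {f g} xs → (∀ {y r} → Picked y r xs → f y r ≈ g y r) → pickSum f xs ≈ pickSum g xs
    pickSum-cong []       f≈g = refl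
    pickSum-cong (z ∷ zs) f≈g = +-cong (f≈g here) (pickSum-cong zs (f≈g ∘ there))

    pickSum-zero : ∀ {f} xs → (∀ {y r} → Picked y r xs → f y r ≈ 0#) → pickSum f xs ≈ 0#
    pickSum-zero []       f≈0 = refl
    pickSum-zero (z ∷ zs) f≈0 = trans (+-cong (f≈0 here) (pickSum-zero zs (f≈0 ∘ there))) (+-identityˡ _)

    pickSum-neg : ∀ f xs → pickSum (λ y r → - f y r) xs ≈ - pickSum f xs
    pickSum-neg f []       = sym -0#≈0#
    pickSum-neg f (z ∷ zs) = trans (+-congˡ (pickSum-neg (λ y r → f y (z ∷ r)) zs)) (⁻¹-∙-comm _ _)

    altPickSum-cong : ∀ {f g} xs → (∀ {y r} → Picked y r xs → f y r ≈ g y r) → altPickSum f xs ≈ altPickSum g xs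
    altPickSum-cong []       f≈g = refl
    altPickSum-cong (z ∷ zs) f≈g = +-cong (f≈g here) (-‿cong (altPickSum-cong zs (f≈g ∘ there)))

    altPickSum-*ˡ : ∀ k f xs → altPickSum (λ y r → k * f y r) xs ≈ k * altPickSum f xs
    altPickSum-*ˡ k f []       = sym (zeroʳ k)
    altPickSum-*ˡ k f (z ∷ zs) = begin
      k * f z zs - altPickSum (λ y r → k * f y (z ∷ r)) zs ≈⟨ +-congˡ (-‿cong (altPickSum-*ˡ k _ zs)) ⟩
      k * f z zs - k * altPickSum (λ y r → f y (z ∷ r)) zs ≈⟨ solve 3 (λ k a b → k :* a :- k :* b := k :* (a :- b)) refl k _ _ ⟩
      k * (f z zs - altPickSum (λ y r → f y (z ∷ r)) zs)   ∎

  altPickSum-map : ∀ {a b} {A : Set a} {B : Set b} (v : A → B) (f : B → List B → Carrier) xs →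
    altPickSum (λ y r → f (v y) (map v r)) xs ≡ altPickSum f (map v xs)
  altPickSum-map v f []       = ≡.refl
  altPickSum-map v f (z ∷ zs) = ≡.cong (λ t → f (v z) (map v zs) - t) (altPickSum-map v (λ u r → f u (v z ∷ r)) zs)

  module _ {a} {A : Set a} where
    ∑perm : List A → (List A → Carrier) → Carrier
    ∑perm xs f = ∑ f (permutations xs)

    ∑perm-∷ : ∀ x xs f → ∑perm (x ∷ xs) f ≈ pickSum (λ y r → ∑perm r (f ∘ (y ∷_))) (x ∷ xs)
    ∑perm-∷ x xs f = begin
      ∑ f (concatMap (insertAll x) (permutations xs))  ≈⟨ ∑-concatMap f (insertAll x) (permutations xs) ⟩
      ∑ (λ σ → ∑ f (insertAll x σ)) (permutations xs)  ≈⟨ ∑-cong (permutations xs) ∑insertAll ⟩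
      ∑ (λ σ → f (x ∷ σ) + later σ) (permutations xs)  ≈⟨ ∑-+ _ _ (permutations xs) ⟩
      ∑perm xs (f ∘ (x ∷_)) + ∑perm xs later           ≈⟨ +-congˡ (∑perm-later xs) ⟩
      ∑perm xs (f ∘ (x ∷_)) + pickSum (λ y r → ∑perm (x ∷ r) (f ∘ (y ∷_))) xs ∎
      where
      later : List A → Carrier
      later []      = 0#
      later (y ∷ σ) = ∑ (f ∘ (y ∷_)) (insertAll x σ)

      ∑insertAll : ∀ σ → ∑ f (insertAll x σ) ≈ f (x ∷ σ) + later σ
      ∑insertAll []      = refl
      ∑insertAll (y ∷ σ) = +-congˡ (reflexive (≡.cong (sumR R) (≡.sym (List.map-∘ (insertAll x σ)))))

      ∑perm-later : ∀ xs → ∑perm xs later ≈ pickSum (λ y r → ∑perm (x ∷ r) (f ∘ (y ∷_))) xs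
      ∑perm-later []       = +-identityʳ _
      ∑perm-later (z ∷ zs) = trans (∑perm-∷ z zs later)
        (pickSum-cong (z ∷ zs) (λ {y} {r} _ → sym (∑-concatMap (f ∘ (y ∷_)) (insertAll x) (permutations r))))

    insertAll-↭ : ∀ (x : A) σ → All (_↭ x ∷ σ) (insertAll x σ)
    insertAll-↭ x []      = ↭.refl ∷ []
    insertAll-↭ x (y ∷ σ) = ↭.refl ∷ All.map⁺ (All.map (λ p → ↭.trans (↭.prep y p) (↭.swap y x ↭.refl)) (insertAll-↭ x σ))

    permutations-↭ : ∀ (xs : List A) → All (_↭ xs) (permutations xs)
    permutations-↭ []       = ↭.refl ∷ []
    permutations-↭ (x ∷ xs) = All.concat⁺ (All.map⁺ (All.map
      (λ σ↭xs → All.map (λ p → ↭.trans p (↭.prep x σ↭xs)) (insertAll-↭ x _)) (permutations-↭ xs)))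

    ∑perm-cong : ∀ {f g} xs → (∀ {π} → π ↭ xs → f π ≈ g π) → ∑perm xs f ≈ ∑perm xs g
    ∑perm-cong xs f≈g = ∑-congᴬ (All.map f≈g (permutations-↭ xs))

    ∑perm-zero : ∀ {f} xs → (∀ {π} → π ↭ xs → f π ≈ 0#) → ∑perm xs f ≈ 0#
    ∑perm-zero xs f≈0 = ∑-zeroᴬ (All.map f≈0 (permutations-↭ xs))

module FirstRowExpansion {c ℓ : Level} (R : CommutativeRing c ℓ) {m : ℕ} (a : Fin m → Fin m → CommutativeRing.Carrier R) where
  open CommutativeRing R
  open IntegerCoefficients R using (solve; _:*_; :-_; con; _:=_)
  open ListSums R
  open import Relation.Binary.Reasoning.Setoid setoid

  pairProduct : List (Fin m) → Carrier
  pairProduct π = prodR R (map (uncurry a) (pairsOf π))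

  pfTerm : List (Fin m) → Carrier
  pfTerm π = if admissible π then sign R π * pairProduct π else 0#

  -- The summand of pf is local to its definition, so it is only characterised pointwise.
  sumR-filter-admissible : ∀ (term : List (Fin m) → Carrier) → (∀ π → term π ≈ sign R π * pairProduct π) →
    ∀ πs → sumR R (map term (filterᵇ admissible πs)) ≈ ∑ pfTerm πs
  sumR-filter-admissible term term≈ []       = refl
  sumR-filter-admissible term term≈ (π ∷ πs) with admissible π
  ... | true  = +-cong (term≈ π) (sumR-filter-admissible term term≈ πs)
  ... | false = trans (sumR-filter-admissible term term≈ πs) (sym (+-identityˡ _))

  pf≈∑perm-pfTerm : pf R m a ≈ ∑perm (allFin m) pfTerm
  pf≈∑perm-pfTerm = sumR-filter-admissible _ (λ _ → refl) (permutations (allFin m))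

  pfTerm-head-not-min : ∀ {x y r π} → x < y → π ↭ x ∷ r → EvenLength (y ∷ π) → pfTerm (y ∷ π) ≈ 0#
  pfTerm-head-not-min {x} {y} {π = π} x<y π↭ even with admissible (y ∷ π) in adm
  ... | false = refl
  ... | true with All-resp-↭ π↭ (admissible⇒head-min y π even adm)
  ...   | y<x ∷ _ = ⊥-elim (ℕ.<-asym x<y y<x)

  sgn : ℕ → Carrier
  sgn k = pow R (- 1#) k

  pow-+ : ∀ u i j → pow R u (i ℕ.+ j) ≈ pow R u i * pow R u j
  pow-+ u zero    j = sym (*-identityˡ _)
  pow-+ u (suc i) j = trans (*-congˡ (pow-+ u i j)) (sym (*-assoc _ _ _))

  pfTerm-∷∷ : ∀ {x y} π → x < y → All (x <_) π → pfTerm (x ∷ y ∷ π) ≈ (sgn (countSmaller y π) * a x y) * pfTerm π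
  pfTerm-∷∷ {x} {y} π x<y x<π = begin
    pfTerm (x ∷ y ∷ π)                          ≡⟨ ≡.cong guarded (admissible-∷∷ π x<y x<π) ⟩
    guarded (admissible π)                      ≈⟨ guarded≈ (admissible π) ⟩
    (sgn (countSmaller y π) * a x y) * pfTerm π ∎
    where
    guarded : Bool → Carrier
    guarded b = if b then sign R (x ∷ y ∷ π) * (a x y * pairProduct π) else 0#

    sign-∷∷ : sign R (x ∷ y ∷ π) ≈ sgn (countSmaller y π) * sign R π
    sign-∷∷ = begin
      sgn (countSmaller x (y ∷ π) ℕ.+ (countSmaller y π ℕ.+ inversions π))
        ≡⟨ ≡.cong (λ k → sgn (k ℕ.+ _)) (countSmaller-min x (y ∷ π) (x<y ∷ x<π)) ⟩
      sgn (countSmaller y π ℕ.+ inversions π) ≈⟨ pow-+ (- 1#) (countSmaller y π) (inversions π) ⟩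
      sgn (countSmaller y π) * sign R π       ∎

    guarded≈ : ∀ b → guarded b ≈ (sgn (countSmaller y π) * a x y) * (if b then sign R π * pairProduct π else 0#)
    guarded≈ true  = trans (*-congʳ sign-∷∷)
      (solve 4 (λ s t b q → (s :* t) :* (b :* q) := (s :* b) :* (t :* q)) refl _ _ _ _)
    guarded≈ false = sym (zeroʳ _)

  pickSum-signed≈altPickSum : ∀ xs → AllPairs _<_ xs → ∀ (f : Fin m → List (Fin m) → Carrier) →
    pickSum (λ y r → sgn (countSmaller y r) * f y r) xs ≈ altPickSum f xs
  pickSum-signed≈altPickSum []       _                f = refl
  pickSum-signed≈altPickSum (z ∷ zs) (z<zs ∷ sorted) f = +-cong head-term (trans tail-terms
    (-‿cong (pickSum-signed≈altPickSum zs sorted (λ y r → f y (z ∷ r)))))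
    where
    head-term : sgn (countSmaller z zs) * f z zs ≈ f z zs
    head-term = trans (*-congʳ (reflexive (≡.cong sgn (countSmaller-min z zs z<zs)))) (*-identityˡ _)

    tail-terms : pickSum (λ y r → sgn (countSmaller y (z ∷ r)) * f y (z ∷ r)) zs
                 ≈ - pickSum (λ y r → sgn (countSmaller y r) * f y (z ∷ r)) zs
    tail-terms = trans (pickSum-cong zs (λ {y} {r} picked → trans
        (*-congʳ (reflexive (≡.cong sgn (countSmaller-∷-< y z r (proj₁ (Picked-All picked z<zs))))))
        (solve 2 (λ s t → (:- con (ℤ.+ 1) :* s) :* t := :- (s :* t)) refl (sgn (countSmaller y r)) (f y (z ∷ r)))))
      (pickSum-neg (λ y r → sgn (countSmaller y r) * f y (z ∷ r)) zs)

  -- Only permutations starting with the minimum x are admissible, and once the second entry y is fixed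
  -- the sign contributes (-1) to the power of the position of y in xs.
  ∑perm-expand : ∀ k x xs → AllPairs _<_ (x ∷ xs) → length (x ∷ xs) ≡ 2 ℕ.* k →
    ∑perm (x ∷ xs) pfTerm ≈ altPickSum (λ y r → a x y * ∑perm r pfTerm) xs
  ∑perm-expand k x [] _ len with length≡2*⇒EvenLength k (x ∷ []) len
  ... | ()
  ∑perm-expand k x xs@(z ∷ zs) (x<xs ∷ sorted) len = begin
    ∑perm (x ∷ xs) pfTerm
      ≈⟨ ∑perm-∷ x xs pfTerm ⟩
    ∑perm xs (pfTerm ∘ (x ∷_)) + pickSum (λ y r → ∑perm (x ∷ r) (pfTerm ∘ (y ∷_))) xs
      ≈⟨ +-congˡ (pickSum-zero xs other-heads) ⟩
    ∑perm xs (pfTerm ∘ (x ∷_)) + 0#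
      ≈⟨ +-identityʳ _ ⟩
    ∑perm xs (pfTerm ∘ (x ∷_))
      ≈⟨ ∑perm-∷ z zs (pfTerm ∘ (x ∷_)) ⟩
    pickSum (λ y r → ∑perm r (λ π → pfTerm (x ∷ y ∷ π))) xs
      ≈⟨ pickSum-cong xs second-heads ⟩
    pickSum (λ y r → sgn (countSmaller y r) * (a x y * ∑perm r pfTerm)) xs
      ≈⟨ pickSum-signed≈altPickSum xs sorted (λ y r → a x y * ∑perm r pfTerm) ⟩
    altPickSum (λ y r → a x y * ∑perm r pfTerm) xs ∎
    where
    other-heads : ∀ {y r} → Picked y r xs → ∑perm (x ∷ r) (pfTerm ∘ (y ∷_)) ≈ 0#
    other-heads {y} {r} picked = ∑perm-zero (x ∷ r) (λ {π} π↭ → pfTerm-head-not-min (proj₁ (Picked-All picked x<xs)) π↭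
      (length≡2*⇒EvenLength k (y ∷ π) (≡.trans (≡.cong suc (≡.trans (↭-length π↭) (≡.sym (Picked-length picked)))) len)))

    second-heads : ∀ {y r} → Picked y r xs →
      ∑perm r (λ π → pfTerm (x ∷ y ∷ π)) ≈ sgn (countSmaller y r) * (a x y * ∑perm r pfTerm)
    second-heads {y} {r} picked = begin
      ∑perm r (λ π → pfTerm (x ∷ y ∷ π))
        ≈⟨ ∑perm-cong r (λ {π} π↭r → trans (pfTerm-∷∷ π x<y (All-resp-↭ (↭.↭-sym π↭r) x<r))
                                            (*-congʳ (*-congʳ (reflexive (≡.cong sgn (countSmaller-↭ y π↭r)))))) ⟩
      ∑perm r (λ π → (sgn (countSmaller y r) * a x y) * pfTerm π)
        ≈⟨ ∑-*ˡ (sgn (countSmaller y r) * a x y) pfTerm (permutations r) ⟩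
      (sgn (countSmaller y r) * a x y) * ∑perm r pfTerm
        ≈⟨ *-assoc _ _ _ ⟩
      sgn (countSmaller y r) * (a x y * ∑perm r pfTerm) ∎
      where
      x<y = proj₁ (Picked-All picked x<xs)
      x<r = proj₂ (Picked-All picked x<xs)

module SquaredDifferences {c ℓ : Level} (R : CommutativeRing c ℓ) where
  open CommutativeRing R
  open IntegerCoefficients R using (Polynomial; solve; _:+_; _:*_; _:-_; :-_; con; _:=_)
  open ListSums R using (altPickSum; altPickSum-cong; altPickSum-*ˡ)
  open import Relation.Binary.Reasoning.Setoid setoid

  chain : Carrier → List Carrier → Carrier → Carrier
  chain b s z = cycGo R z (b ∷ s)

  openChain : Carrier → List Carrier → Carrier
  openChain a []       = 1#
  openChain a (s ∷ ss) = (a - s) * openChain s ss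

  last : Carrier → List Carrier → Carrier
  last a []       = a
  last a (s ∷ ss) = last s ss

  chain≈openChain* : ∀ b s z → chain b s z ≈ openChain b s * (last b s - z)
  chain≈openChain* b []       z = sym (*-identityˡ _)
  chain≈openChain* b (s ∷ ss) z = trans (*-congˡ (chain≈openChain* s ss z)) (sym (*-assoc _ _ _))

  -- The quadratic in y with value P′(t) at t ∈ {a, L} and -P′(t) at t ∈ {b, z}, where P = (y - a)(y - L)(y - b)(y - z).
  Φ : Carrier → Carrier → Carrier → Carrier → Carrier → Carrier
  Φ y b z a L = y * y * (a + L - b - z) - (y + y) * (a * L - b * z) + a * L * (b + z) - b * z * (a + L)

  Φᴾ : ∀ {n} → Polynomial n → Polynomial n → Polynomial n → Polynomial n → Polynomial n → Polynomial n
  Φᴾ y b z a L = y :* y :* (a :+ L :- b :- z) :- (y :+ y) :* (a :* L :- b :* z) :+ a :* L :* (b :+ z) :- b :* z :* (a :+ L)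

  altPickSum-squares-chain : ∀ y b z a s → EvenLength (a ∷ s) →
    altPickSum (λ u r → (y - u) * (y - u) * chain b r z) (a ∷ s) ≈ openChain a s * Φ y b z a (last a s)
  altPickSum-squares-chain y b z a (c ∷ []) _ =
    solve 5 (λ y b z a c →
        (y :- a) :* (y :- a) :* ((b :- c) :* (c :- z)) :- ((y :- c) :* (y :- c) :* ((b :- a) :* (a :- z)) :- con (ℤ.+ 0))
      := ((a :- c) :* con (ℤ.+ 1)) :* Φᴾ y b z a c)
      refl y b z a c
  altPickSum-squares-chain y b z a (c ∷ d ∷ u) (pair d∷u-even) = begin
    altPickSum (λ u′ r → (y - u′) * (y - u′) * chain b r z) (a ∷ c ∷ d ∷ u)
      ≈⟨ +-congˡ (-‿cong (+-congˡ (-‿cong tail-sum))) ⟩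
    (y - a) * (y - a) * ((b - c) * ((c - d) * chain d u z))
      - ((y - c) * (y - c) * ((b - a) * ((a - d) * chain d u z)) - ((b - a) * (a - c)) * (openChain d u * Φ y c z d L))
      ≈⟨ +-cong (*-congˡ (*-congˡ (*-congˡ (chain≈openChain* d u z))))
                (-‿cong (+-congʳ (*-congˡ (*-congˡ (*-congˡ (chain≈openChain* d u z)))))) ⟩
    (y - a) * (y - a) * ((b - c) * ((c - d) * (openChain d u * (L - z))))
      - ((y - c) * (y - c) * ((b - a) * ((a - d) * (openChain d u * (L - z)))) - ((b - a) * (a - c)) * (openChain d u * Φ y c z d L))
      ≈⟨ solve 8 (λ y b z a c d L X →
           (y :- a) :* (y :- a) :* ((b :- c) :* ((c :- d) :* (X :* (L :- z))))
             :- ((y :- c) :* (y :- c) :* ((b :- a) :* ((a :- d) :* (X :* (L :- z))))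
                 :- ((b :- a) :* (a :- c)) :* (X :* Φᴾ y c z d L))
           := ((a :- c) :* ((c :- d) :* X)) :* Φᴾ y b z a L)
         refl y b z a c d L (openChain d u) ⟩
    openChain a (c ∷ d ∷ u) * Φ y b z a L ∎
    where
    L = last d u
    tail-sum : altPickSum (λ u′ r → (y - u′) * (y - u′) * chain b (a ∷ c ∷ r) z) (d ∷ u)
               ≈ ((b - a) * (a - c)) * (openChain d u * Φ y c z d L)
    tail-sum = begin
      altPickSum (λ u′ r → (y - u′) * (y - u′) * chain b (a ∷ c ∷ r) z) (d ∷ u)
        ≈⟨ altPickSum-cong (d ∷ u) (λ {u′} {r} _ → solve 4 (λ s p q w → s :* (p :* (q :* w)) := (p :* q) :* (s :* w))
                                                      refl ((y - u′) * (y - u′)) (b - a) (a - c) (chain c r z)) ⟩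
      altPickSum (λ u′ r → ((b - a) * (a - c)) * ((y - u′) * (y - u′) * chain c r z)) (d ∷ u)
        ≈⟨ altPickSum-*ˡ ((b - a) * (a - c)) (λ u′ r → (y - u′) * (y - u′) * chain c r z) (d ∷ u) ⟩
      ((b - a) * (a - c)) * altPickSum (λ u′ r → (y - u′) * (y - u′) * chain c r z) (d ∷ u)
        ≈⟨ *-congˡ (altPickSum-squares-chain y c z d u d∷u-even) ⟩
      ((b - a) * (a - c)) * (openChain d u * Φ y c z d L) ∎

  altPickSum-squares-cyclic : ∀ v z a s → EvenLength (a ∷ s) →
    altPickSum (λ u r → (v - u) * (v - u) * cyclicDiffProd R r) (z ∷ a ∷ s) ≈ (- two R) * cyclicDiffProd R (v ∷ z ∷ a ∷ s)
  altPickSum-squares-cyclic v z a s a∷s-even = begin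
    (v - z) * (v - z) * chain a s a - altPickSum (λ u r → (v - u) * (v - u) * chain z r z) (a ∷ s)
      ≈⟨ +-cong (*-congˡ (chain≈openChain* a s a)) (-‿cong (altPickSum-squares-chain v z z a s a∷s-even)) ⟩
    (v - z) * (v - z) * (openChain a s * (L - a)) - openChain a s * Φ v z z a L
      ≈⟨ solve 5 (λ v z a L X →
           (v :- z) :* (v :- z) :* (X :* (L :- a))
             :- X :* Φᴾ v z z a L
           := (:- con (ℤ.+ 2)) :* ((v :- z) :* ((z :- a) :* (X :* (L :- v)))))
         refl v z a L (openChain a s) ⟩
    (- two R) * ((v - z) * ((z - a) * (openChain a s * (L - v))))
      ≈⟨ *-congˡ (*-congˡ (*-congˡ (sym (chain≈openChain* a s v)))) ⟩
    (- two R) * ((v - z) * ((z - a) * chain a s v)) ∎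
    where L = last a s

  -- The empty Pfaffian is 1, which the formula for n ≥ 1 does not cover.
  closedForm : ℕ → List Carrier → Carrier
  closedForm zero    ys = 1#
  closedForm (suc h) ys = - (pow R (- two R) h * cyclicDiffProd R ys)

  altPickSum-squares-closedForm : ∀ h v ws → length ws ≡ suc (2 ℕ.* h) →
    altPickSum (λ u r → (v - u) * (v - u) * closedForm h r) ws ≈ closedForm (suc h) (v ∷ ws)
  altPickSum-squares-closedForm zero v (u ∷ []) _ =
    solve 2 (λ v u → (v :- u) :* (v :- u) :* con (ℤ.+ 1) :- con (ℤ.+ 0) := :- (con (ℤ.+ 1) :* ((v :- u) :* (u :- v)))) refl v u
  altPickSum-squares-closedForm (suc h) v ws@(z ∷ a ∷ s) len = begin
    altPickSum (λ u r → (v - u) * (v - u) * - (P * cyclicDiffProd R r)) ws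
      ≈⟨ altPickSum-cong ws (λ {u} {r} _ → solve 3 (λ q P c → q :* (:- (P :* c)) := (:- P) :* (q :* c))
                                              refl ((v - u) * (v - u)) P (cyclicDiffProd R r)) ⟩
    altPickSum (λ u r → (- P) * ((v - u) * (v - u) * cyclicDiffProd R r)) ws
      ≈⟨ altPickSum-*ˡ (- P) (λ u r → (v - u) * (v - u) * cyclicDiffProd R r) ws ⟩
    (- P) * altPickSum (λ u r → (v - u) * (v - u) * cyclicDiffProd R r) ws
      ≈⟨ *-congˡ (altPickSum-squares-cyclic v z a s (length≡2*⇒EvenLength (suc h) (a ∷ s) (ℕ.suc-injective len))) ⟩
    (- P) * ((- two R) * cyclicDiffProd R (v ∷ ws))
      ≈⟨ solve 2 (λ P c → (:- P) :* ((:- con (ℤ.+ 2)) :* c) := :- (((:- con (ℤ.+ 2)) :* P) :* c)) refl P (cyclicDiffProd R (v ∷ ws)) ⟩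
    closedForm (suc (suc h)) (v ∷ ws) ∎
    where P = pow R (- two R) h

module SquaredDifferencePfaffian {c ℓ : Level} (R : CommutativeRing c ℓ) {m : ℕ} (x : Fin m → CommutativeRing.Carrier R) where
  open CommutativeRing R
  open ListSums R using (∑perm; Picked; Picked-AllPairs; Picked-length; altPickSum; altPickSum-cong; altPickSum-map)
  open FirstRowExpansion R (λ i j → (x i - x j) * (x i - x j)) public using (pf≈∑perm-pfTerm)
  open FirstRowExpansion R (λ i j → (x i - x j) * (x i - x j)) using (pfTerm; ∑perm-expand)
  open SquaredDifferences R using (closedForm; altPickSum-squares-closedForm)
  open import Relation.Binary.Reasoning.Setoid setoid

  ∑perm-pfTerm≈closedForm : ∀ h is → AllPairs _<_ is → length is ≡ 2 ℕ.* h → ∑perm is pfTerm ≈ closedForm h (map x is)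
  ∑perm-pfTerm≈closedForm zero    []       _ _ = trans (+-identityʳ _) (*-identityʳ _)
  ∑perm-pfTerm≈closedForm (suc h) (i ∷ is) sorted@(_ ∷ is-sorted) len = begin
    ∑perm (i ∷ is) pfTerm
      ≈⟨ ∑perm-expand (suc h) i is sorted len ⟩
    altPickSum (λ j r → (x i - x j) * (x i - x j) * ∑perm r pfTerm) is
      ≈⟨ altPickSum-cong is (λ picked → *-congˡ (∑perm-pfTerm≈closedForm h _ (Picked-AllPairs picked is-sorted) (length-rest picked))) ⟩
    altPickSum (λ j r → (x i - x j) * (x i - x j) * closedForm h (map x r)) is
      ≡⟨ altPickSum-map x (λ u r → (x i - u) * (x i - u) * closedForm h r) is ⟩
    altPickSum (λ u r → (x i - u) * (x i - u) * closedForm h r) (map x is)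
      ≈⟨ altPickSum-squares-closedForm h (x i) (map x is) (≡.trans (List.length-map x is) length-is) ⟩
    closedForm (suc h) (x i ∷ map x is) ∎
    where
    length-is : length is ≡ suc (2 ℕ.* h)
    length-is = ℕ.suc-injective (≡.trans len (ℕ.*-suc 2 h))

    length-rest : ∀ {j r} → Picked j r is → length r ≡ 2 ℕ.* h
    length-rest picked = ℕ.suc-injective (≡.trans (≡.sym (Picked-length picked)) length-is)

open import Data.Nat using (_*_; _∸_; _≤_)

theorem1p3 : {c ℓ : Level} (R : CommutativeRing c ℓ) →
    ¬ (CommutativeRing._≈_ R (two R) (CommutativeRing.0# R)) →
    (n : ℕ) → 1 ≤ n → (x : Fin (2 * n) → CommutativeRing.Carrier R) →
    CommutativeRing._≈_ R
      (pf R (2 * n) (λ i j → CommutativeRing._*_ R (CommutativeRing._-_ R (x i) (x j)) (CommutativeRing._-_ R (x i) (x j))))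
      (CommutativeRing.-_ R (CommutativeRing._*_ R (pow R (CommutativeRing.-_ R (two R)) (n ∸ 1)) (cyclicDiffProd R (map x (allFin (2 * n))))))
theorem1p3 R _ n@(suc h) (s≤s z≤n) x =
  trans pf≈∑perm-pfTerm
        (∑perm-pfTerm≈closedForm n (allFin (2 * n)) (AllPairs.tabulate⁺-< id) (List.length-tabulate id))
  where
  open CommutativeRing R using (trans)
  open SquaredDifferencePfaffian R x
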